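{- For every derivation from $W_4$ to $Z_4$ in the system $\{\mathsf{ai}\downarrow,\mathsf{ai}\uparrow,\mathsf{s},\mathsf{q}\downarrow,\mathsf{q}\uparrow,\mathsf{p}\downarrow,\mathsf{p}\uparrow\}$ there is a derivation of the shape $W_4\xrightarrow{\{\mathsf{ai}\downarrow\}}W_5\xrightarrow{\mathsf{SNELh}}Z_5\xrightarrow{\{\mathsf{ai}\uparrow\}}Z_4$ for some structures $W_5,Z_5$.
   Context: Atoms: countably many atoms $a,b,\dots$, each atom $a$ having a dual atom $\bar a$ with $\bar{\bar a}=a$. Structures are generated by $S::= a\mid \circ \mid [S,\dots,S]\mid (S,\dots,S)\mid \langle S;\dots;S\rangle \mid ?S\mid !S\mid \bar S$ (par, tensor, seq with at least one argument; unit $\circ$ not an atom), identified modulo the least congruence $=$ making par, tensor, seq associative, par and tensor commutative, $\circ$ a unit for all three, $[R]=(R)=\langle R\rangle=R$, with $\bar\circ=\circ$, $\overline{[R_1,\dots,R_h]}=(\bar R_1,\dots,\bar R_h)$, $\overline{(R_1,\dots,R_h)}=[\bar R_1,\dots,\bar R_h]$, $\overline{\langle R_1;\dots;R_h\rangle}=\langle\bar R_1;\dots;\bar R_h\rangle$, $\overline{?R}=!\bar R$, $\overline{!R}=?\bar R$, $\bar{\bar R}=R$. A context $S\{\;\}$ is a structure with one hole not under negation; $S[R,T]$ abbreviates $S\{[R,T]\}$ etc. A derivation in a rule set is a finite vertical chain of rule instances (each conclusion equal modulo $=$ to the next premise), possibly a single structure; top = premise, bottom = conclusion. Rules (premise $\Rightarrow$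 conclusion): $\mathsf{ai}\downarrow$: $S\{\circ\}\Rightarrow S[a,\bar a]$; $\mathsf{ai}\uparrow$: $S(a,\bar a)\Rightarrow S\{\circ\}$; $\mathsf{s}$: $S([R,U],T)\Rightarrow S[(R,T),U]$; $\mathsf{q}\downarrow$: $S\langle[R,U];[T,V]\rangle\Rightarrow S[\langle R;T\rangle,\langle U;V\rangle]$; $\mathsf{q}\uparrow$: $S(\langle R;U\rangle,\langle T;V\rangle)\Rightarrow S\langle(R,T);(U,V)\rangle$; $\mathsf{p}\downarrow$: $S\{![R,T]\}\Rightarrow S[!R,?T]$; $\mathsf{p}\uparrow$: $S(?R,!T)\Rightarrow S\{?(R,T)\}$. $\mathsf{SNELh}=\{\mathsf{s},\mathsf{q}\downarrow,\mathsf{q}\uparrow,\mathsf{p}\downarrow,\mathsf{p}\uparrow\}$. Notation $X_0\xrightarrow{\mathcal X_1}X_1\xrightarrow{\mathcal X_2}\cdots\xrightarrow{\mathcal X_k}X_k$ denotes a derivation from $X_0$ to $X_k$ obtained by stacking, for each $i$, a derivation from $X_{i-1}$ to $X_i$ using only rules of $\mathcal X_i$ (possibly with no rule instance). -}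

module Defs where

open import Data.Nat using (ℕ)
open import Data.Bool using (Bool; not)
open import Data.Product using (_×_; _,_)
open import Data.Unit using (⊤)
open import Relation.Binary.PropositionalEquality using (_≡_)

-- Atoms: countably many; an atom is a name together with a polarity.
-- The dual of an atom flips the polarity, so dual (dual a) ≡ a.
Atom : Set
Atom = ℕ × Bool

dual : Atom → Atom
dual (n , b) = n , not b

-- Raw structures.  Par, tensor and seq are taken binary: since they are
-- associative with unit ∘ and [R] = (R) = ⟨R⟩ = R, every n-ary structure
-- (n ≥ 1) equals (modulo ≈) a nested binary one.
data Str : Set where
  atom : Atom → Str
  ∘    : Str
  par  : Str → Str → Str   -- [R , T]
  tens : Str → Str → Str   -- (R , T)
  seq  : Str → Str → Str   -- ⟨R ; T⟩
  wn   : Str → Str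
  oc   : Str → Str
  neg  : Str → Str

infix 4 _≈_

data _≈_ : Str → Str → Set where
  ≈-refl  : ∀ {R} → R ≈ R
  ≈-sym   : ∀ {R T} → R ≈ T → T ≈ R
  ≈-trans : ∀ {R T U} → R ≈ T → T ≈ U → R ≈ U
  par-cong  : ∀ {R R' T T'} → R ≈ R' → T ≈ T' → par R T ≈ par R' T'
  tens-cong : ∀ {R R' T T'} → R ≈ R' → T ≈ T' → tens R T ≈ tens R' T'
  seq-cong  : ∀ {R R' T T'} → R ≈ R' → T ≈ T' → seq R T ≈ seq R' T'
  wn-cong   : ∀ {R R'} → R ≈ R' → wn R ≈ wn R'
  oc-cong   : ∀ {R R'} → R ≈ R' → oc R ≈ oc R'
  neg-cong  : ∀ {R R'} → R ≈ R' → neg R ≈ neg R'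
  par-assoc  : ∀ {R T U} → par (par R T) U ≈ par R (par T U)
  tens-assoc : ∀ {R T U} → tens (tens R T) U ≈ tens R (tens T U)
  seq-assoc  : ∀ {R T U} → seq (seq R T) U ≈ seq R (seq T U)
  par-comm  : ∀ {R T} → par R T ≈ par T R
  tens-comm : ∀ {R T} → tens R T ≈ tens T R
  par-unitˡ  : ∀ {R} → par ∘ R ≈ R
  par-unitʳ  : ∀ {R} → par R ∘ ≈ R
  tens-unitˡ : ∀ {R} → tens ∘ R ≈ R
  tens-unitʳ : ∀ {R} → tens R ∘ ≈ R
  seq-unitˡ  : ∀ {R} → seq ∘ R ≈ R
  seq-unitʳ  : ∀ {R} → seq R ∘ ≈ R
  neg-atom : ∀ {a} → neg (atom a) ≈ atom (dual a)
  neg-unit : neg ∘ ≈ ∘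
  neg-par  : ∀ {R T} → neg (par R T) ≈ tens (neg R) (neg T)
  neg-tens : ∀ {R T} → neg (tens R T) ≈ par (neg R) (neg T)
  neg-seq  : ∀ {R T} → neg (seq R T) ≈ seq (neg R) (neg T)
  neg-wn   : ∀ {R} → neg (wn R) ≈ oc (neg R)
  neg-oc   : ∀ {R} → neg (oc R) ≈ wn (neg R)
  neg-neg  : ∀ {R} → neg (neg R) ≈ R

-- Contexts: structures with one hole, not under negation.
data Ctx : Set where
  hole  : Ctx
  parˡ  : Ctx → Str → Ctx
  parʳ  : Str → Ctx → Ctx
  tensˡ : Ctx → Str → Ctx
  tensʳ : Str → Ctx → Ctx
  seqˡ  : Ctx → Str → Ctx
  seqʳ  : Str → Ctx → Ctx
  wnᶜ   : Ctx → Ctx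
  ocᶜ   : Ctx → Ctx

_⟦_⟧ : Ctx → Str → Str
hole      ⟦ R ⟧ = R
parˡ K S  ⟦ R ⟧ = par (K ⟦ R ⟧) S
parʳ S K  ⟦ R ⟧ = par S (K ⟦ R ⟧)
tensˡ K S ⟦ R ⟧ = tens (K ⟦ R ⟧) S
tensʳ S K ⟦ R ⟧ = tens S (K ⟦ R ⟧)
seqˡ K S  ⟦ R ⟧ = seq (K ⟦ R ⟧) S
seqʳ S K  ⟦ R ⟧ = seq S (K ⟦ R ⟧)
wnᶜ K     ⟦ R ⟧ = wn (K ⟦ R ⟧)
ocᶜ K     ⟦ R ⟧ = oc (K ⟦ R ⟧)

data Rule : Set where
  ai↓ ai↑ s q↓ q↑ p↓ p↑ : Rule

-- Inst r P C : P ⇒ C is an instance of rule r (premise P, conclusion C).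
data Inst : Rule → Str → Str → Set where
  ai↓-i : ∀ K a → Inst ai↓ (K ⟦ ∘ ⟧) (K ⟦ par (atom a) (atom (dual a)) ⟧)
  ai↑-i : ∀ K a → Inst ai↑ (K ⟦ tens (atom a) (atom (dual a)) ⟧) (K ⟦ ∘ ⟧)
  s-i   : ∀ K R T U → Inst s (K ⟦ tens (par R U) T ⟧) (K ⟦ par (tens R T) U ⟧)
  q↓-i  : ∀ K R T U V →
          Inst q↓ (K ⟦ seq (par R U) (par T V) ⟧) (K ⟦ par (seq R T) (seq U V) ⟧)
  q↑-i  : ∀ K R T U V →
          Inst q↑ (K ⟦ tens (seq R U) (seq T V) ⟧) (K ⟦ seq (tens R T) (tens U V) ⟧)
  p↓-i  : ∀ K R T → Inst p↓ (K ⟦ oc (par R T) ⟧) (K ⟦ par (oc R) (wn T) ⟧)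
  p↑-i  : ∀ K R T → Inst p↑ (K ⟦ tens (wn R) (oc T) ⟧) (K ⟦ wn (tens R T) ⟧)

RuleSet : Set₁
RuleSet = Rule → Set

data Deriv (𝓡 : RuleSet) : Str → Str → Set where
  stop : ∀ {W Z} → W ≈ Z → Deriv 𝓡 W Z
  step : ∀ {W P C Z} (r : Rule) → 𝓡 r → W ≈ P → Inst r P C → Deriv 𝓡 C Z →
         Deriv 𝓡 W Z

AllRules : RuleSet
AllRules _ = ⊤

Only : Rule → RuleSet
Only r r' = r' ≡ r

data SNELh : RuleSet where
  s∈  : SNELh s
  q↓∈ : SNELh q↓
  q↑∈ : SNELh q↑
  p↓∈ : SNELh p↓
  p↑∈ : SNELh p↑

-- Since ∘ is a unit for par, tensor and seq, an ai↓ instance amounts to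
-- joining [a, ā] to some substructure by par, tensor or seq.  Unlike a unit
-- position, such an insertion point can be traced back across the structural
-- equations and through any rule instance above it: it becomes an insertion
-- point of the premise, at the price of a few extra s, q↓ and q↑ instances
-- that carry the inserted structure to its place.  Hence all ai↓ instances
-- permute to the top.  Negating a derivation turns it upside down and swaps
-- ai↓ with ai↑, so the same argument sends the ai↑ instances to the bottom.
-- Negations are first pushed to the atoms, after which the equations without
-- the negation laws are all that is needed.
module Submission where

open import Defs
open import Data.Product using (Σ; _×_; _,_)
open import Data.Sum using (_⊎_; inj₁; inj₂)
import Data.Sum as Sum
open import Data.Bool using (true; false)
open import Relation.Binary.PropositionalEquality
  using (_≡_; refl; sym; trans; cong; cong₂; subst; subst₂)

data Axiom : Str → Str → Set where
  par-assoc  : ∀ {R T U} → Axiom (par (par R T) U) (par R (par T U))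
  tens-assoc : ∀ {R T U} → Axiom (tens (tens R T) U) (tens R (tens T U))
  seq-assoc  : ∀ {R T U} → Axiom (seq (seq R T) U) (seq R (seq T U))
  par-comm   : ∀ {R T} → Axiom (par R T) (par T R)
  tens-comm  : ∀ {R T} → Axiom (tens R T) (tens T R)
  par-unitˡ  : ∀ {R} → Axiom (par ∘ R) R
  par-unitʳ  : ∀ {R} → Axiom (par R ∘) R
  tens-unitˡ : ∀ {R} → Axiom (tens ∘ R) R
  tens-unitʳ : ∀ {R} → Axiom (tens R ∘) R
  seq-unitˡ  : ∀ {R} → Axiom (seq ∘ R) R
  seq-unitʳ  : ∀ {R} → Axiom (seq R ∘) R

infix 4 _≃_
data _≃_ : Str → Str → Set where
  ≃-refl    : ∀ {R} → R ≃ R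
  ≃-sym     : ∀ {R T} → R ≃ T → T ≃ R
  ≃-trans   : ∀ {R T U} → R ≃ T → T ≃ U → R ≃ U
  par-cong  : ∀ {R R' T T'} → R ≃ R' → T ≃ T' → par R T ≃ par R' T'
  tens-cong : ∀ {R R' T T'} → R ≃ R' → T ≃ T' → tens R T ≃ tens R' T'
  seq-cong  : ∀ {R R' T T'} → R ≃ R' → T ≃ T' → seq R T ≃ seq R' T'
  wn-cong   : ∀ {R R'} → R ≃ R' → wn R ≃ wn R'
  oc-cong   : ∀ {R R'} → R ≃ R' → oc R ≃ oc R'
  axiom     : ∀ {R T} → Axiom R T → R ≃ T

Axiom⇒≈ : ∀ {X Y} → Axiom X Y → X ≈ Y
Axiom⇒≈ par-assoc  = par-assoc
Axiom⇒≈ tens-assoc = tens-assoc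
Axiom⇒≈ seq-assoc  = seq-assoc
Axiom⇒≈ par-comm   = par-comm
Axiom⇒≈ tens-comm  = tens-comm
Axiom⇒≈ par-unitˡ  = par-unitˡ
Axiom⇒≈ par-unitʳ  = par-unitʳ
Axiom⇒≈ tens-unitˡ = tens-unitˡ
Axiom⇒≈ tens-unitʳ = tens-unitʳ
Axiom⇒≈ seq-unitˡ  = seq-unitˡ
Axiom⇒≈ seq-unitʳ  = seq-unitʳ

≃⇒≈ : ∀ {X Y} → X ≃ Y → X ≈ Y
≃⇒≈ ≃-refl          = ≈-refl
≃⇒≈ (≃-sym p)       = ≈-sym (≃⇒≈ p)
≃⇒≈ (≃-trans p q)   = ≈-trans (≃⇒≈ p) (≃⇒≈ q)
≃⇒≈ (par-cong p q)  = par-cong (≃⇒≈ p) (≃⇒≈ q)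
≃⇒≈ (tens-cong p q) = tens-cong (≃⇒≈ p) (≃⇒≈ q)
≃⇒≈ (seq-cong p q)  = seq-cong (≃⇒≈ p) (≃⇒≈ q)
≃⇒≈ (wn-cong p)     = wn-cong (≃⇒≈ p)
≃⇒≈ (oc-cong p)     = oc-cong (≃⇒≈ p)
≃⇒≈ (axiom a)       = Axiom⇒≈ a

≡⇒≃ : ∀ {X Y} → X ≡ Y → X ≃ Y
≡⇒≃ refl = ≃-refl

_∙ᶜ_ : Ctx → Ctx → Ctx
hole      ∙ᶜ K = K
parˡ L S  ∙ᶜ K = parˡ (L ∙ᶜ K) S
parʳ S L  ∙ᶜ K = parʳ S (L ∙ᶜ K)
tensˡ L S ∙ᶜ K = tensˡ (L ∙ᶜ K) S
tensʳ S L ∙ᶜ K = tensʳ S (L ∙ᶜ K)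
seqˡ L S  ∙ᶜ K = seqˡ (L ∙ᶜ K) S
seqʳ S L  ∙ᶜ K = seqʳ S (L ∙ᶜ K)
wnᶜ L     ∙ᶜ K = wnᶜ (L ∙ᶜ K)
ocᶜ L     ∙ᶜ K = ocᶜ (L ∙ᶜ K)

⟦⟧-∙ᶜ : ∀ L K X → (L ∙ᶜ K) ⟦ X ⟧ ≡ L ⟦ K ⟦ X ⟧ ⟧
⟦⟧-∙ᶜ hole        K X = refl
⟦⟧-∙ᶜ (parˡ L S)  K X = cong (λ Y → par Y S) (⟦⟧-∙ᶜ L K X)
⟦⟧-∙ᶜ (parʳ S L)  K X = cong (par S) (⟦⟧-∙ᶜ L K X)
⟦⟧-∙ᶜ (tensˡ L S) K X = cong (λ Y → tens Y S) (⟦⟧-∙ᶜ L K X)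
⟦⟧-∙ᶜ (tensʳ S L) K X = cong (tens S) (⟦⟧-∙ᶜ L K X)
⟦⟧-∙ᶜ (seqˡ L S)  K X = cong (λ Y → seq Y S) (⟦⟧-∙ᶜ L K X)
⟦⟧-∙ᶜ (seqʳ S L)  K X = cong (seq S) (⟦⟧-∙ᶜ L K X)
⟦⟧-∙ᶜ (wnᶜ L)     K X = cong wn (⟦⟧-∙ᶜ L K X)
⟦⟧-∙ᶜ (ocᶜ L)     K X = cong oc (⟦⟧-∙ᶜ L K X)

Inst-unnest : ∀ {r} L K {P C} → Inst r ((L ∙ᶜ K) ⟦ P ⟧) ((L ∙ᶜ K) ⟦ C ⟧) →
              Inst r (L ⟦ K ⟦ P ⟧ ⟧) (L ⟦ K ⟦ C ⟧ ⟧)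
Inst-unnest L K = subst₂ (Inst _) (⟦⟧-∙ᶜ L K _) (⟦⟧-∙ᶜ L K _)

Inst-plug : ∀ {r P C} (L : Ctx) → Inst r P C → Inst r (L ⟦ P ⟧) (L ⟦ C ⟧)
Inst-plug L (ai↓-i K a)      = Inst-unnest L K (ai↓-i (L ∙ᶜ K) a)
Inst-plug L (ai↑-i K a)      = Inst-unnest L K (ai↑-i (L ∙ᶜ K) a)
Inst-plug L (s-i K R T U)    = Inst-unnest L K (s-i (L ∙ᶜ K) R T U)
Inst-plug L (q↓-i K R T U V) = Inst-unnest L K (q↓-i (L ∙ᶜ K) R T U V)
Inst-plug L (q↑-i K R T U V) = Inst-unnest L K (q↑-i (L ∙ᶜ K) R T U V)
Inst-plug L (p↓-i K R T)     = Inst-unnest L K (p↓-i (L ∙ᶜ K) R T)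
Inst-plug L (p↑-i K R T)     = Inst-unnest L K (p↑-i (L ∙ᶜ K) R T)

⟦⟧-cong : ∀ (L : Ctx) {X Y} → X ≃ Y → L ⟦ X ⟧ ≃ L ⟦ Y ⟧
⟦⟧-cong hole        p = p
⟦⟧-cong (parˡ L S)  p = par-cong (⟦⟧-cong L p) ≃-refl
⟦⟧-cong (parʳ S L)  p = par-cong ≃-refl (⟦⟧-cong L p)
⟦⟧-cong (tensˡ L S) p = tens-cong (⟦⟧-cong L p) ≃-refl
⟦⟧-cong (tensʳ S L) p = tens-cong ≃-refl (⟦⟧-cong L p)
⟦⟧-cong (seqˡ L S)  p = seq-cong (⟦⟧-cong L p) ≃-refl
⟦⟧-cong (seqʳ S L)  p = seq-cong ≃-refl (⟦⟧-cong L p)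
⟦⟧-cong (wnᶜ L)     p = wn-cong (⟦⟧-cong L p)
⟦⟧-cong (ocᶜ L)     p = oc-cong (⟦⟧-cong L p)

_⊆_ : RuleSet → RuleSet → Set
𝓡 ⊆ 𝓢 = ∀ {r} → 𝓡 r → 𝓢 r

_∪_ : RuleSet → RuleSet → RuleSet
(𝓡 ∪ 𝓢) r = 𝓡 r ⊎ 𝓢 r

data Der (𝓡 : RuleSet) : Str → Str → Set where
  stop : ∀ {W Z} → W ≃ Z → Der 𝓡 W Z
  step : ∀ {W P C Z} (r : Rule) → 𝓡 r → W ≃ P → Inst r P C → Der 𝓡 C Z →
         Der 𝓡 W Z

infixr 6 _◅_ _++_
infixl 5 _▻_

_◅_ : ∀ {𝓡 X Y Z} → X ≃ Y → Der 𝓡 Y Z → Der 𝓡 X Z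
p ◅ stop q         = stop (≃-trans p q)
p ◅ step r e q i d = step r e (≃-trans p q) i d

_++_ : ∀ {𝓡 X Y Z} → Der 𝓡 X Y → Der 𝓡 Y Z → Der 𝓡 X Z
stop p         ++ d' = p ◅ d'
step r e p i d ++ d' = step r e p i (d ++ d')

_▻_ : ∀ {𝓡 X Y Z} → Der 𝓡 X Y → Y ≃ Z → Der 𝓡 X Z
d ▻ q = d ++ stop q

single : ∀ {𝓡 r P C} → 𝓡 r → Inst r P C → Der 𝓡 P C
single {r = r} e i = step r e ≃-refl i (stop ≃-refl)

Der-plug : ∀ {𝓡 X Y} (L : Ctx) → Der 𝓡 X Y → Der 𝓡 (L ⟦ X ⟧) (L ⟦ Y ⟧)
Der-plug L (stop p)         = stop (⟦⟧-cong L p)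
Der-plug L (step r e p i d) = step r e (⟦⟧-cong L p) (Inst-plug L i) (Der-plug L d)

Der-mono : ∀ {𝓡 𝓢} → 𝓡 ⊆ 𝓢 → ∀ {X Y} → Der 𝓡 X Y → Der 𝓢 X Y
Der-mono f (stop p)         = stop p
Der-mono f (step r e p i d) = step r (f e) p i (Der-mono f d)

data Junction : Set where
  by-par by-tens before after : Junction

junction : Junction → Str → Ctx
junction by-par  U = parˡ hole U
junction by-tens U = tensˡ hole U
junction before  U = seqʳ U hole
junction after   U = seqˡ hole U

join : Junction → Str → Str → Str
join j X U = junction j U ⟦ X ⟧

join-∘ : ∀ j U → join j ∘ U ≃ U
join-∘ by-par  U = axiom par-unitˡ
join-∘ by-tens U = axiom tens-unitˡ
join-∘ before  U = axiom seq-unitʳ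
join-∘ after   U = axiom seq-unitˡ

-- Ins U X Y : Y is X with U joined to one occurrence of a substructure.
data Ins (U : Str) : Str → Str → Set where
  here      : ∀ j X → Ins U X (join j X U)
  ins-parˡ  : ∀ {R R' T} → Ins U R R' → Ins U (par R T) (par R' T)
  ins-parʳ  : ∀ {R R' T} → Ins U R R' → Ins U (par T R) (par T R')
  ins-tensˡ : ∀ {R R' T} → Ins U R R' → Ins U (tens R T) (tens R' T)
  ins-tensʳ : ∀ {R R' T} → Ins U R R' → Ins U (tens T R) (tens T R')
  ins-seqˡ  : ∀ {R R' T} → Ins U R R' → Ins U (seq R T) (seq R' T)
  ins-seqʳ  : ∀ {R R' T} → Ins U R R' → Ins U (seq T R) (seq T R')
  ins-wn    : ∀ {R R'} → Ins U R R' → Ins U (wn R) (wn R')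
  ins-oc    : ∀ {R R'} → Ins U R R' → Ins U (oc R) (oc R')

Ins-at-hole : ∀ {U} (K : Ctx) → Ins U (K ⟦ ∘ ⟧) (K ⟦ par ∘ U ⟧)
Ins-at-hole hole        = here by-par ∘
Ins-at-hole (parˡ K S)  = ins-parˡ (Ins-at-hole K)
Ins-at-hole (parʳ S K)  = ins-parʳ (Ins-at-hole K)
Ins-at-hole (tensˡ K S) = ins-tensˡ (Ins-at-hole K)
Ins-at-hole (tensʳ S K) = ins-tensʳ (Ins-at-hole K)
Ins-at-hole (seqˡ K S)  = ins-seqˡ (Ins-at-hole K)
Ins-at-hole (seqʳ S K)  = ins-seqʳ (Ins-at-hole K)
Ins-at-hole (wnᶜ K)     = ins-wn (Ins-at-hole K)
Ins-at-hole (ocᶜ K)     = ins-oc (Ins-at-hole K)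

Ins⇒unit-hole : ∀ {U X Y} → Ins U X Y →
                Σ Ctx λ K → X ≃ K ⟦ ∘ ⟧ × Y ≃ K ⟦ U ⟧
Ins⇒unit-hole (here by-par X)  = parʳ X hole , ≃-sym (axiom par-unitʳ) , ≃-refl
Ins⇒unit-hole (here by-tens X) = tensʳ X hole , ≃-sym (axiom tens-unitʳ) , ≃-refl
Ins⇒unit-hole (here before X)  = seqˡ hole X , ≃-sym (axiom seq-unitˡ) , ≃-refl
Ins⇒unit-hole (here after X)   = seqʳ X hole , ≃-sym (axiom seq-unitʳ) , ≃-refl
Ins⇒unit-hole (ins-parˡ i) with Ins⇒unit-hole i
... | K , p , q = parˡ K _ , par-cong p ≃-refl , par-cong q ≃-refl
Ins⇒unit-hole (ins-parʳ i) with Ins⇒unit-hole i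
... | K , p , q = parʳ _ K , par-cong ≃-refl p , par-cong ≃-refl q
Ins⇒unit-hole (ins-tensˡ i) with Ins⇒unit-hole i
... | K , p , q = tensˡ K _ , tens-cong p ≃-refl , tens-cong q ≃-refl
Ins⇒unit-hole (ins-tensʳ i) with Ins⇒unit-hole i
... | K , p , q = tensʳ _ K , tens-cong ≃-refl p , tens-cong ≃-refl q
Ins⇒unit-hole (ins-seqˡ i) with Ins⇒unit-hole i
... | K , p , q = seqˡ K _ , seq-cong p ≃-refl , seq-cong q ≃-refl
Ins⇒unit-hole (ins-seqʳ i) with Ins⇒unit-hole i
... | K , p , q = seqʳ _ K , seq-cong ≃-refl p , seq-cong ≃-refl q
Ins⇒unit-hole (ins-wn i) with Ins⇒unit-hole i
... | K , p , q = wnᶜ K , wn-cong p , wn-cong q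
Ins⇒unit-hole (ins-oc i) with Ins⇒unit-hole i
... | K , p , q = ocᶜ K , oc-cong p , oc-cong q

InsThen : RuleSet → Str → Str → Str → Set
InsThen 𝓡 U X Y = Σ Str λ X' → Ins U X X' × Der 𝓡 X' Y

join-parʳ : ∀ j N V U → Der SNELh (join j (par N V) U) (par N (join j V U))
join-parʳ by-par N V U = stop (axiom par-assoc)
join-parʳ by-tens N V U =
  ⟦⟧-cong (junction by-tens U) (axiom par-comm)
    ◅ single s∈ (s-i hole V U N) ▻ axiom par-comm
join-parʳ before N V U =
  seq-cong (≃-sym (axiom par-unitˡ)) ≃-refl
    ◅ single q↓∈ (q↓-i hole ∘ N U V) ▻ par-cong (axiom seq-unitˡ) ≃-refl
join-parʳ after N V U =
  seq-cong ≃-refl (≃-sym (axiom par-unitˡ))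
    ◅ single q↓∈ (q↓-i hole N ∘ V U) ▻ par-cong (axiom seq-unitʳ) ≃-refl

join-parˡ : ∀ j N V U → Der SNELh (join j (par N V) U) (par (join j N U) V)
join-parˡ j N V U =
  ⟦⟧-cong (junction j U) (axiom par-comm) ◅ join-parʳ j V N U ▻ axiom par-comm

join-tens : ∀ j R T U → Der SNELh (tens (join j R U) T) (join j (tens R T) U)
join-tens by-par R T U = single s∈ (s-i hole R T U)
join-tens by-tens R T U = stop
  (≃-trans (axiom tens-assoc)
    (≃-trans (tens-cong ≃-refl (axiom tens-comm)) (≃-sym (axiom tens-assoc))))
join-tens before R T U =
  tens-cong ≃-refl (≃-sym (axiom seq-unitˡ))
    ◅ single q↑∈ (q↑-i hole U ∘ R T) ▻ seq-cong (axiom tens-unitʳ) ≃-refl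
join-tens after R T U =
  tens-cong ≃-refl (≃-sym (axiom seq-unitʳ))
    ◅ single q↑∈ (q↑-i hole R T U ∘) ▻ seq-cong ≃-refl (axiom tens-unitʳ)

Ins-axiom : ∀ {W X Y D} → Axiom X Y → Ins W Y D → InsThen SNELh W X D
Ins-axiom {W} a (here j _) = _ , here j _ , stop (⟦⟧-cong (junction j W) (axiom a))
Ins-axiom par-assoc (ins-parˡ i) = _ , ins-parˡ (ins-parˡ i) , stop (axiom par-assoc)
Ins-axiom {W} (par-assoc {R} {T} {V}) (ins-parʳ (here j _)) =
  _ , here j _ , ⟦⟧-cong (junction j W) (axiom par-assoc) ◅ join-parʳ j R (par T V) W
Ins-axiom par-assoc (ins-parʳ (ins-parˡ i)) = _ , ins-parˡ (ins-parʳ i) , stop (axiom par-assoc)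
Ins-axiom par-assoc (ins-parʳ (ins-parʳ i)) = _ , ins-parʳ i , stop (axiom par-assoc)
Ins-axiom par-comm (ins-parˡ i) = _ , ins-parʳ i , stop (axiom par-comm)
Ins-axiom par-comm (ins-parʳ i) = _ , ins-parˡ i , stop (axiom par-comm)
Ins-axiom par-unitˡ i = _ , ins-parʳ i , stop (axiom par-unitˡ)
Ins-axiom par-unitʳ i = _ , ins-parˡ i , stop (axiom par-unitʳ)
Ins-axiom tens-assoc (ins-tensˡ i) = _ , ins-tensˡ (ins-tensˡ i) , stop (axiom tens-assoc)
Ins-axiom {W} (tens-assoc {R} {T} {V}) (ins-tensʳ (here j _)) =
  _ , ins-tensˡ (ins-tensʳ (here j T)) ,
  axiom tens-assoc ◅ Der-plug (tensʳ R hole) (join-tens j T V W)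
Ins-axiom tens-assoc (ins-tensʳ (ins-tensˡ i)) =
  _ , ins-tensˡ (ins-tensʳ i) , stop (axiom tens-assoc)
Ins-axiom tens-assoc (ins-tensʳ (ins-tensʳ i)) = _ , ins-tensʳ i , stop (axiom tens-assoc)
Ins-axiom tens-comm (ins-tensˡ i) = _ , ins-tensʳ i , stop (axiom tens-comm)
Ins-axiom tens-comm (ins-tensʳ i) = _ , ins-tensˡ i , stop (axiom tens-comm)
Ins-axiom tens-unitˡ i = _ , ins-tensʳ i , stop (axiom tens-unitˡ)
Ins-axiom tens-unitʳ i = _ , ins-tensˡ i , stop (axiom tens-unitʳ)
Ins-axiom seq-assoc (ins-seqˡ i) = _ , ins-seqˡ (ins-seqˡ i) , stop (axiom seq-assoc)
Ins-axiom {W} (seq-assoc {R} {T} {V}) (ins-seqʳ (here by-par _)) =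
  _ , ins-seqʳ (here by-par V) ,
  ≃-trans (axiom seq-assoc) (seq-cong ≃-refl (seq-cong (≃-sym (axiom par-unitʳ)) ≃-refl))
    ◅ single q↓∈ (q↓-i (seqʳ R hole) T V ∘ W)
    ▻ seq-cong ≃-refl (par-cong ≃-refl (axiom seq-unitˡ))
Ins-axiom {W} (seq-assoc {R} {T} {V}) (ins-seqʳ (here by-tens _)) =
  _ , here by-tens _ ,
  tens-cong (axiom seq-assoc) (≃-sym (axiom seq-unitˡ))
    ◅ single q↑∈ (q↑-i hole R ∘ (seq T V) W) ▻ seq-cong (axiom tens-unitʳ) ≃-refl
Ins-axiom (seq-assoc {R}) (ins-seqʳ (here before _)) =
  _ , ins-seqˡ (ins-seqˡ (here after R)) , stop (≃-trans (axiom seq-assoc) (axiom seq-assoc))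
Ins-axiom (seq-assoc {U = V}) (ins-seqʳ (here after _)) =
  _ , ins-seqʳ (here after V) ,
  stop (≃-trans (axiom seq-assoc) (seq-cong ≃-refl (≃-sym (axiom seq-assoc))))
Ins-axiom seq-assoc (ins-seqʳ (ins-seqˡ i)) = _ , ins-seqˡ (ins-seqʳ i) , stop (axiom seq-assoc)
Ins-axiom seq-assoc (ins-seqʳ (ins-seqʳ i)) = _ , ins-seqʳ i , stop (axiom seq-assoc)
Ins-axiom seq-unitˡ i = _ , ins-seqʳ i , stop (axiom seq-unitˡ)
Ins-axiom seq-unitʳ i = _ , ins-seqˡ i , stop (axiom seq-unitʳ)

Ins-axiom⁻ : ∀ {W X Y D} → Axiom X Y → Ins W X D → InsThen SNELh W Y D
Ins-axiom⁻ {W} a (here j _) = _ , here j _ , stop (⟦⟧-cong (junction j W) (≃-sym (axiom a)))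
Ins-axiom⁻ {W} (par-assoc {R} {T} {V}) (ins-parˡ (here j _)) =
  _ , here j _ ,
  ⟦⟧-cong (junction j W) (≃-sym (axiom par-assoc)) ◅ join-parˡ j (par R T) V W
Ins-axiom⁻ par-assoc (ins-parˡ (ins-parˡ i)) =
  _ , ins-parˡ i , stop (≃-sym (axiom par-assoc))
Ins-axiom⁻ par-assoc (ins-parˡ (ins-parʳ i)) =
  _ , ins-parʳ (ins-parˡ i) , stop (≃-sym (axiom par-assoc))
Ins-axiom⁻ par-assoc (ins-parʳ i) =
  _ , ins-parʳ (ins-parʳ i) , stop (≃-sym (axiom par-assoc))
Ins-axiom⁻ par-comm (ins-parˡ i) = _ , ins-parʳ i , stop (axiom par-comm)
Ins-axiom⁻ par-comm (ins-parʳ i) = _ , ins-parˡ i , stop (axiom par-comm)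
Ins-axiom⁻ {W} par-unitˡ (ins-parˡ (here j _)) =
  _ , here by-par _ , stop (≃-trans (axiom par-comm) (par-cong (≃-sym (join-∘ j W)) ≃-refl))
Ins-axiom⁻ par-unitˡ (ins-parʳ i) = _ , i , stop (≃-sym (axiom par-unitˡ))
Ins-axiom⁻ par-unitʳ (ins-parˡ i) = _ , i , stop (≃-sym (axiom par-unitʳ))
Ins-axiom⁻ {W} par-unitʳ (ins-parʳ (here j _)) =
  _ , here by-par _ , stop (par-cong ≃-refl (≃-sym (join-∘ j W)))
Ins-axiom⁻ {W} (tens-assoc {R} {T} {V}) (ins-tensˡ (here j _)) =
  _ , ins-tensˡ (here j R) ,
  ≃-sym (axiom tens-assoc) ◅ Der-plug (tensˡ hole V) (join-tens j R T W)
Ins-axiom⁻ tens-assoc (ins-tensˡ (ins-tensˡ i)) =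
  _ , ins-tensˡ i , stop (≃-sym (axiom tens-assoc))
Ins-axiom⁻ tens-assoc (ins-tensˡ (ins-tensʳ i)) =
  _ , ins-tensʳ (ins-tensˡ i) , stop (≃-sym (axiom tens-assoc))
Ins-axiom⁻ tens-assoc (ins-tensʳ i) =
  _ , ins-tensʳ (ins-tensʳ i) , stop (≃-sym (axiom tens-assoc))
Ins-axiom⁻ tens-comm (ins-tensˡ i) = _ , ins-tensʳ i , stop (axiom tens-comm)
Ins-axiom⁻ tens-comm (ins-tensʳ i) = _ , ins-tensˡ i , stop (axiom tens-comm)
Ins-axiom⁻ {W} tens-unitˡ (ins-tensˡ (here j _)) =
  _ , here by-tens _ ,
  stop (≃-trans (axiom tens-comm) (tens-cong (≃-sym (join-∘ j W)) ≃-refl))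
Ins-axiom⁻ tens-unitˡ (ins-tensʳ i) = _ , i , stop (≃-sym (axiom tens-unitˡ))
Ins-axiom⁻ tens-unitʳ (ins-tensˡ i) = _ , i , stop (≃-sym (axiom tens-unitʳ))
Ins-axiom⁻ {W} tens-unitʳ (ins-tensʳ (here j _)) =
  _ , here by-tens _ , stop (tens-cong ≃-refl (≃-sym (join-∘ j W)))
Ins-axiom⁻ {W} (seq-assoc {R} {T} {V}) (ins-seqˡ (here by-par _)) =
  _ , ins-seqˡ (here by-par R) ,
  ≃-trans (seq-cong ≃-refl (seq-cong (≃-sym (axiom par-unitʳ)) ≃-refl))
          (≃-sym (axiom seq-assoc))
    ◅ single q↓∈ (q↓-i (seqˡ hole V) R T W ∘)
    ▻ seq-cong (par-cong ≃-refl (axiom seq-unitʳ)) ≃-refl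
Ins-axiom⁻ {W} (seq-assoc {R} {T} {V}) (ins-seqˡ (here by-tens _)) =
  _ , here by-tens _ ,
  tens-cong (≃-sym (axiom seq-assoc)) (≃-sym (axiom seq-unitʳ))
    ◅ single q↑∈ (q↑-i hole (seq R T) W V ∘) ▻ seq-cong ≃-refl (axiom tens-unitʳ)
Ins-axiom⁻ (seq-assoc {R}) (ins-seqˡ (here before _)) =
  _ , ins-seqˡ (here before R) ,
  stop (≃-trans (≃-sym (axiom seq-assoc)) (seq-cong (axiom seq-assoc) ≃-refl))
Ins-axiom⁻ (seq-assoc {T = T}) (ins-seqˡ (here after _)) =
  _ , ins-seqʳ (ins-seqˡ (here after T)) ,
  stop (≃-trans (≃-sym (axiom seq-assoc)) (seq-cong (≃-sym (axiom seq-assoc)) ≃-refl))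
Ins-axiom⁻ seq-assoc (ins-seqˡ (ins-seqˡ i)) =
  _ , ins-seqˡ i , stop (≃-sym (axiom seq-assoc))
Ins-axiom⁻ seq-assoc (ins-seqˡ (ins-seqʳ i)) =
  _ , ins-seqʳ (ins-seqˡ i) , stop (≃-sym (axiom seq-assoc))
Ins-axiom⁻ seq-assoc (ins-seqʳ i) =
  _ , ins-seqʳ (ins-seqʳ i) , stop (≃-sym (axiom seq-assoc))
Ins-axiom⁻ {W} seq-unitˡ (ins-seqˡ (here j _)) =
  _ , here before _ , stop (seq-cong (≃-sym (join-∘ j W)) ≃-refl)
Ins-axiom⁻ seq-unitˡ (ins-seqʳ i) = _ , i , stop (≃-sym (axiom seq-unitˡ))
Ins-axiom⁻ seq-unitʳ (ins-seqˡ i) = _ , i , stop (≃-sym (axiom seq-unitʳ))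
Ins-axiom⁻ {W} seq-unitʳ (ins-seqʳ (here j _)) =
  _ , here after _ , stop (seq-cong ≃-refl (≃-sym (join-∘ j W)))

Ins-≃  : ∀ {W X Y D} → X ≃ Y → Ins W Y D → InsThen SNELh W X D
Ins-≃⁻ : ∀ {W X Y D} → X ≃ Y → Ins W X D → InsThen SNELh W Y D

Ins-≃ {W} p (here j _) = _ , here j _ , stop (⟦⟧-cong (junction j W) p)
Ins-≃ ≃-refl i = _ , i , stop ≃-refl
Ins-≃ (≃-sym p) i = Ins-≃⁻ p i
Ins-≃ (≃-trans p q) i with Ins-≃ q i
... | _ , i₁ , d₁ with Ins-≃ p i₁
... | _ , i₂ , d₂ = _ , i₂ , d₂ ++ d₁
Ins-≃ (par-cong p q) (ins-parˡ i) with Ins-≃ p i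
... | _ , i' , d = _ , ins-parˡ i' , Der-plug (parˡ hole _) d ▻ par-cong ≃-refl q
Ins-≃ (par-cong p q) (ins-parʳ i) with Ins-≃ q i
... | _ , i' , d = _ , ins-parʳ i' , Der-plug (parʳ _ hole) d ▻ par-cong p ≃-refl
Ins-≃ (tens-cong p q) (ins-tensˡ i) with Ins-≃ p i
... | _ , i' , d = _ , ins-tensˡ i' , Der-plug (tensˡ hole _) d ▻ tens-cong ≃-refl q
Ins-≃ (tens-cong p q) (ins-tensʳ i) with Ins-≃ q i
... | _ , i' , d = _ , ins-tensʳ i' , Der-plug (tensʳ _ hole) d ▻ tens-cong p ≃-refl
Ins-≃ (seq-cong p q) (ins-seqˡ i) with Ins-≃ p i
... | _ , i' , d = _ , ins-seqˡ i' , Der-plug (seqˡ hole _) d ▻ seq-cong ≃-refl q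
Ins-≃ (seq-cong p q) (ins-seqʳ i) with Ins-≃ q i
... | _ , i' , d = _ , ins-seqʳ i' , Der-plug (seqʳ _ hole) d ▻ seq-cong p ≃-refl
Ins-≃ (wn-cong p) (ins-wn i) with Ins-≃ p i
... | _ , i' , d = _ , ins-wn i' , Der-plug (wnᶜ hole) d
Ins-≃ (oc-cong p) (ins-oc i) with Ins-≃ p i
... | _ , i' , d = _ , ins-oc i' , Der-plug (ocᶜ hole) d
Ins-≃ (axiom a) i = Ins-axiom a i

Ins-≃⁻ {W} p (here j _) = _ , here j _ , stop (⟦⟧-cong (junction j W) (≃-sym p))
Ins-≃⁻ ≃-refl i = _ , i , stop ≃-refl
Ins-≃⁻ (≃-sym p) i = Ins-≃ p i
Ins-≃⁻ (≃-trans p q) i with Ins-≃⁻ p i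
... | _ , i₁ , d₁ with Ins-≃⁻ q i₁
... | _ , i₂ , d₂ = _ , i₂ , d₂ ++ d₁
Ins-≃⁻ (par-cong p q) (ins-parˡ i) with Ins-≃⁻ p i
... | _ , i' , d = _ , ins-parˡ i' , Der-plug (parˡ hole _) d ▻ par-cong ≃-refl (≃-sym q)
Ins-≃⁻ (par-cong p q) (ins-parʳ i) with Ins-≃⁻ q i
... | _ , i' , d = _ , ins-parʳ i' , Der-plug (parʳ _ hole) d ▻ par-cong (≃-sym p) ≃-refl
Ins-≃⁻ (tens-cong p q) (ins-tensˡ i) with Ins-≃⁻ p i
... | _ , i' , d = _ , ins-tensˡ i' , Der-plug (tensˡ hole _) d ▻ tens-cong ≃-refl (≃-sym q)
Ins-≃⁻ (tens-cong p q) (ins-tensʳ i) with Ins-≃⁻ q i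
... | _ , i' , d = _ , ins-tensʳ i' , Der-plug (tensʳ _ hole) d ▻ tens-cong (≃-sym p) ≃-refl
Ins-≃⁻ (seq-cong p q) (ins-seqˡ i) with Ins-≃⁻ p i
... | _ , i' , d = _ , ins-seqˡ i' , Der-plug (seqˡ hole _) d ▻ seq-cong ≃-refl (≃-sym q)
Ins-≃⁻ (seq-cong p q) (ins-seqʳ i) with Ins-≃⁻ q i
... | _ , i' , d = _ , ins-seqʳ i' , Der-plug (seqʳ _ hole) d ▻ seq-cong (≃-sym p) ≃-refl
Ins-≃⁻ (wn-cong p) (ins-wn i) with Ins-≃⁻ p i
... | _ , i' , d = _ , ins-wn i' , Der-plug (wnᶜ hole) d
Ins-≃⁻ (oc-cong p) (ins-oc i) with Ins-≃⁻ p i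
... | _ , i' , d = _ , ins-oc i' , Der-plug (ocᶜ hole) d
Ins-≃⁻ (axiom a) i = Ins-axiom⁻ a i

Ins-ai↓ : ∀ {X Y} a → Ins (par (atom a) (atom (dual a))) X Y → Der (Only ai↓) X Y
Ins-ai↓ a i with Ins⇒unit-hole i
... | K , p , q = step ai↓ refl p (ai↓-i K a) (stop (≃-sym q))

module _ {𝓡 : RuleSet} (sub : SNELh ⊆ 𝓡) where

  ≃-InsThen : ∀ {U X Y D} → X ≃ Y → InsThen 𝓡 U Y D → InsThen 𝓡 U X D
  ≃-InsThen p (_ , i , d) with Ins-≃ p i
  ... | _ , i' , d' = _ , i' , Der-mono sub d' ++ d

  join-above : ∀ {r U P C} j → 𝓡 r → Inst r P C → InsThen 𝓡 U P (join j C U)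
  join-above {U = U} j e inst = _ , here j _ , single e (Inst-plug (junction j U) inst)

  join-above-parˡ : ∀ {r U P N V} j → 𝓡 r → Inst r P (par N V) →
                    InsThen 𝓡 U P (par (join j N U) V)
  join-above-parˡ {U = U} {N = N} {V} j e inst with join-above j e inst
  ... | _ , i , d = _ , i , d ++ Der-mono sub (join-parˡ j N V U)

  join-above-parʳ : ∀ {r U P N V} j → 𝓡 r → Inst r P (par N V) →
                    InsThen 𝓡 U P (par N (join j V U))
  join-above-parʳ {U = U} {N = N} {V} j e inst with join-above j e inst
  ... | _ , i , d = _ , i , d ++ Der-mono sub (join-parʳ j N V U)

  Ins-up-plug : ∀ {r U P C} → 𝓡 r → Inst r P C →
                (∀ {D} → Ins U C D → InsThen 𝓡 U P D) →
                ∀ K {D} → Ins U (K ⟦ C ⟧) D → InsThen 𝓡 U (K ⟦ P ⟧) D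
  Ins-up-plug e inst up hole i = up i
  Ins-up-plug e inst up K (here j _) = join-above j e (Inst-plug K inst)
  Ins-up-plug e inst up (parˡ K S) (ins-parˡ i) with Ins-up-plug e inst up K i
  ... | _ , i' , d = _ , ins-parˡ i' , Der-plug (parˡ hole S) d
  Ins-up-plug e inst up (parˡ K S) (ins-parʳ i) =
    _ , ins-parʳ i , single e (Inst-plug (parˡ K _) inst)
  Ins-up-plug e inst up (parʳ S K) (ins-parʳ i) with Ins-up-plug e inst up K i
  ... | _ , i' , d = _ , ins-parʳ i' , Der-plug (parʳ S hole) d
  Ins-up-plug e inst up (parʳ S K) (ins-parˡ i) =
    _ , ins-parˡ i , single e (Inst-plug (parʳ _ K) inst)
  Ins-up-plug e inst up (tensˡ K S) (ins-tensˡ i) with Ins-up-plug e inst up K i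
  ... | _ , i' , d = _ , ins-tensˡ i' , Der-plug (tensˡ hole S) d
  Ins-up-plug e inst up (tensˡ K S) (ins-tensʳ i) =
    _ , ins-tensʳ i , single e (Inst-plug (tensˡ K _) inst)
  Ins-up-plug e inst up (tensʳ S K) (ins-tensʳ i) with Ins-up-plug e inst up K i
  ... | _ , i' , d = _ , ins-tensʳ i' , Der-plug (tensʳ S hole) d
  Ins-up-plug e inst up (tensʳ S K) (ins-tensˡ i) =
    _ , ins-tensˡ i , single e (Inst-plug (tensʳ _ K) inst)
  Ins-up-plug e inst up (seqˡ K S) (ins-seqˡ i) with Ins-up-plug e inst up K i
  ... | _ , i' , d = _ , ins-seqˡ i' , Der-plug (seqˡ hole S) d
  Ins-up-plug e inst up (seqˡ K S) (ins-seqʳ i) =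
    _ , ins-seqʳ i , single e (Inst-plug (seqˡ K _) inst)
  Ins-up-plug e inst up (seqʳ S K) (ins-seqʳ i) with Ins-up-plug e inst up K i
  ... | _ , i' , d = _ , ins-seqʳ i' , Der-plug (seqʳ S hole) d
  Ins-up-plug e inst up (seqʳ S K) (ins-seqˡ i) =
    _ , ins-seqˡ i , single e (Inst-plug (seqʳ _ K) inst)
  Ins-up-plug e inst up (wnᶜ K) (ins-wn i) with Ins-up-plug e inst up K i
  ... | _ , i' , d = _ , ins-wn i' , Der-plug (wnᶜ hole) d
  Ins-up-plug e inst up (ocᶜ K) (ins-oc i) with Ins-up-plug e inst up K i
  ... | _ , i' , d = _ , ins-oc i' , Der-plug (ocᶜ hole) d

  Ins-up-ai↓ : ∀ {U D} a → 𝓡 ai↓ →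
               Ins U (par (atom a) (atom (dual a))) D → InsThen 𝓡 U ∘ D
  Ins-up-ai↓ a e (here j _)            = join-above j e (ai↓-i hole a)
  Ins-up-ai↓ a e (ins-parˡ (here j _)) = join-above-parˡ j e (ai↓-i hole a)
  Ins-up-ai↓ a e (ins-parʳ (here j _)) = join-above-parʳ j e (ai↓-i hole a)

  Ins-up-ai↑ : ∀ {U D} a → 𝓡 ai↑ →
               Ins U ∘ D → InsThen 𝓡 U (tens (atom a) (atom (dual a))) D
  Ins-up-ai↑ {U} a e (here j _) =
    _ , here by-tens _ ,
    single e (ai↑-i (tensˡ hole U) a) ▻ ≃-trans (axiom tens-unitˡ) (≃-sym (join-∘ j U))

  Ins-up-s : ∀ {U D} R T V → 𝓡 s →
             Ins U (par (tens R T) V) D → InsThen 𝓡 U (tens (par R V) T) D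
  Ins-up-s R T V e (here j _)            = join-above j e (s-i hole R T V)
  Ins-up-s R T V e (ins-parˡ (here j _)) = join-above-parˡ j e (s-i hole R T V)
  Ins-up-s R T V e (ins-parˡ (ins-tensˡ i)) =
    _ , ins-tensˡ (ins-parˡ i) , single e (s-i hole _ T V)
  Ins-up-s R T V e (ins-parˡ (ins-tensʳ i)) = _ , ins-tensʳ i , single e (s-i hole R _ V)
  Ins-up-s R T V e (ins-parʳ i) = _ , ins-tensˡ (ins-parʳ i) , single e (s-i hole R T _)

  Ins-up-q↓ : ∀ {W D} R T U V → 𝓡 q↓ →
              Ins W (par (seq R T) (seq U V)) D → InsThen 𝓡 W (seq (par R U) (par T V)) D
  Ins-up-q↓ R T U V e (here j _)             = join-above j e (q↓-i hole R T U V)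
  Ins-up-q↓ R T U V e (ins-parˡ (here j _))  = join-above-parˡ j e (q↓-i hole R T U V)
  Ins-up-q↓ R T U V e (ins-parˡ (ins-seqˡ i)) =
    _ , ins-seqˡ (ins-parˡ i) , single e (q↓-i hole _ T U V)
  Ins-up-q↓ R T U V e (ins-parˡ (ins-seqʳ i)) =
    _ , ins-seqʳ (ins-parˡ i) , single e (q↓-i hole R _ U V)
  Ins-up-q↓ R T U V e (ins-parʳ (here j _))  = join-above-parʳ j e (q↓-i hole R T U V)
  Ins-up-q↓ R T U V e (ins-parʳ (ins-seqˡ i)) =
    _ , ins-seqˡ (ins-parʳ i) , single e (q↓-i hole R T _ V)
  Ins-up-q↓ R T U V e (ins-parʳ (ins-seqʳ i)) =
    _ , ins-seqʳ (ins-parʳ i) , single e (q↓-i hole R T U _)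

  Ins-up-q↑ : ∀ {W D} R T U V → 𝓡 q↑ →
              Ins W (seq (tens R T) (tens U V)) D → InsThen 𝓡 W (tens (seq R U) (seq T V)) D
  Ins-up-q↑ R T U V e (here j _) = join-above j e (q↑-i hole R T U V)
  Ins-up-q↑ {W} R T U V e (ins-seqˡ (here j _)) =
    _ , ins-tensˡ (ins-seqˡ (here j R)) ,
    single e (q↑-i hole (join j R W) T U V)
      ++ Der-plug (seqˡ hole (tens U V)) (Der-mono sub (join-tens j R T W))
  Ins-up-q↑ R T U V e (ins-seqˡ (ins-tensˡ i)) =
    _ , ins-tensˡ (ins-seqˡ i) , single e (q↑-i hole _ T U V)
  Ins-up-q↑ R T U V e (ins-seqˡ (ins-tensʳ i)) =
    _ , ins-tensʳ (ins-seqˡ i) , single e (q↑-i hole R _ U V)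
  Ins-up-q↑ {W} R T U V e (ins-seqʳ (here j _)) =
    _ , ins-tensˡ (ins-seqʳ (here j U)) ,
    single e (q↑-i hole R T (join j U W) V)
      ++ Der-plug (seqʳ (tens R T) hole) (Der-mono sub (join-tens j U V W))
  Ins-up-q↑ R T U V e (ins-seqʳ (ins-tensˡ i)) =
    _ , ins-tensˡ (ins-seqʳ i) , single e (q↑-i hole R T _ V)
  Ins-up-q↑ R T U V e (ins-seqʳ (ins-tensʳ i)) =
    _ , ins-tensʳ (ins-seqʳ i) , single e (q↑-i hole R T U _)

  Ins-up-p↓ : ∀ {W D} R T → 𝓡 p↓ →
              Ins W (par (oc R) (wn T)) D → InsThen 𝓡 W (oc (par R T)) D
  Ins-up-p↓ R T e (here j _)            = join-above j e (p↓-i hole R T)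
  Ins-up-p↓ R T e (ins-parˡ (here j _)) = join-above-parˡ j e (p↓-i hole R T)
  Ins-up-p↓ R T e (ins-parˡ (ins-oc i)) = _ , ins-oc (ins-parˡ i) , single e (p↓-i hole _ T)
  Ins-up-p↓ R T e (ins-parʳ (here j _)) = join-above-parʳ j e (p↓-i hole R T)
  Ins-up-p↓ R T e (ins-parʳ (ins-wn i)) = _ , ins-oc (ins-parʳ i) , single e (p↓-i hole R _)

  Ins-up-p↑ : ∀ {W D} R T → 𝓡 p↑ →
              Ins W (wn (tens R T)) D → InsThen 𝓡 W (tens (wn R) (oc T)) D
  Ins-up-p↑ R T e (here j _) = join-above j e (p↑-i hole R T)
  Ins-up-p↑ {W} R T e (ins-wn (here j _)) =
    _ , ins-tensˡ (ins-wn (here j R)) ,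
    single e (p↑-i hole (join j R W) T)
      ++ Der-plug (wnᶜ hole) (Der-mono sub (join-tens j R T W))
  Ins-up-p↑ R T e (ins-wn (ins-tensˡ i)) = _ , ins-tensˡ (ins-wn i) , single e (p↑-i hole _ T)
  Ins-up-p↑ R T e (ins-wn (ins-tensʳ i)) = _ , ins-tensʳ (ins-oc i) , single e (p↑-i hole R _)

  Ins-up-inst : ∀ {r P C U D} → 𝓡 r → Inst r P C → Ins U C D → InsThen 𝓡 U P D
  Ins-up-inst e (ai↓-i K a)      = Ins-up-plug e (ai↓-i hole a) (Ins-up-ai↓ a e) K
  Ins-up-inst e (ai↑-i K a)      = Ins-up-plug e (ai↑-i hole a) (Ins-up-ai↑ a e) K
  Ins-up-inst e (s-i K R T U)    = Ins-up-plug e (s-i hole R T U) (Ins-up-s R T U e) K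
  Ins-up-inst e (q↓-i K R T U V) = Ins-up-plug e (q↓-i hole R T U V) (Ins-up-q↓ R T U V e) K
  Ins-up-inst e (q↑-i K R T U V) = Ins-up-plug e (q↑-i hole R T U V) (Ins-up-q↑ R T U V e) K
  Ins-up-inst e (p↓-i K R T)     = Ins-up-plug e (p↓-i hole R T) (Ins-up-p↓ R T e) K
  Ins-up-inst e (p↑-i K R T)     = Ins-up-plug e (p↑-i hole R T) (Ins-up-p↑ R T e) K

  Ins-up : ∀ {U P C D} → Der 𝓡 P C → Ins U C D → InsThen 𝓡 U P D
  Ins-up (stop p) i = ≃-InsThen p (_ , i , stop ≃-refl)
  Ins-up (step r e p inst d) i with Ins-up d i
  ... | _ , i₁ , d₁ with Ins-up-inst e inst i₁
  ... | _ , i₂ , d₂ = ≃-InsThen p (_ , i₂ , d₂ ++ d₁)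

  permute-ai↓-up : ∀ {X C M} → Der 𝓡 X C → Der (Only ai↓) C M →
                   Σ Str λ X' → Der (Only ai↓) X X' × Der 𝓡 X' M
  permute-ai↓-up d (stop q) = _ , stop ≃-refl , d ▻ q
  permute-ai↓-up d (step .ai↓ refl q (ai↓-i K a) rest) with Ins-up (d ▻ q) (Ins-at-hole K)
  ... | _ , i , d₁ with permute-ai↓-up (d₁ ▻ ⟦⟧-cong K (axiom par-unitˡ)) rest
  ... | X' , a' , d' = X' , Ins-ai↓ a i ++ a' , d'

  ai↓-to-top : ∀ {W Z} → Der (𝓡 ∪ Only ai↓) W Z →
               Σ Str λ M → Der (Only ai↓) W M × Der 𝓡 M Z
  ai↓-to-top (stop p) = _ , stop ≃-refl , stop p
  ai↓-to-top (step r (inj₁ e) p inst rest) with ai↓-to-top rest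
  ... | M , a , d with permute-ai↓-up (step r e p inst (stop ≃-refl)) a
  ... | X' , a' , d' = X' , a' , d' ++ d
  ai↓-to-top (step .ai↓ (inj₂ refl) p inst rest) with ai↓-to-top rest
  ... | M , a , d = M , step ai↓ refl p inst a , d

-- De Morgan dual of a negation-free structure.
negate : Str → Str
negate (atom a)   = atom (dual a)
negate ∘          = ∘
negate (par R T)  = tens (negate R) (negate T)
negate (tens R T) = par (negate R) (negate T)
negate (seq R T)  = seq (negate R) (negate T)
negate (wn R)     = oc (negate R)
negate (oc R)     = wn (negate R)
negate (neg R)    = neg (negate R)

dual-involutive : ∀ a → dual (dual a) ≡ a
dual-involutive (n , true)  = refl
dual-involutive (n , false) = refl

negate-involutive : ∀ X → negate (negate X) ≡ X
negate-involutive (atom a)   = cong atom (dual-involutive a)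
negate-involutive ∘          = refl
negate-involutive (par R T)  = cong₂ par (negate-involutive R) (negate-involutive T)
negate-involutive (tens R T) = cong₂ tens (negate-involutive R) (negate-involutive T)
negate-involutive (seq R T)  = cong₂ seq (negate-involutive R) (negate-involutive T)
negate-involutive (wn R)     = cong wn (negate-involutive R)
negate-involutive (oc R)     = cong oc (negate-involutive R)
negate-involutive (neg R)    = cong neg (negate-involutive R)

negateᶜ : Ctx → Ctx
negateᶜ hole        = hole
negateᶜ (parˡ K S)  = tensˡ (negateᶜ K) (negate S)
negateᶜ (parʳ S K)  = tensʳ (negate S) (negateᶜ K)
negateᶜ (tensˡ K S) = parˡ (negateᶜ K) (negate S)
negateᶜ (tensʳ S K) = parʳ (negate S) (negateᶜ K)
negateᶜ (seqˡ K S)  = seqˡ (negateᶜ K) (negate S)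
negateᶜ (seqʳ S K)  = seqʳ (negate S) (negateᶜ K)
negateᶜ (wnᶜ K)     = ocᶜ (negateᶜ K)
negateᶜ (ocᶜ K)     = wnᶜ (negateᶜ K)

negate-⟦⟧ : ∀ K X → negate (K ⟦ X ⟧) ≡ negateᶜ K ⟦ negate X ⟧
negate-⟦⟧ hole        X = refl
negate-⟦⟧ (parˡ K S)  X = cong (λ Y → tens Y (negate S)) (negate-⟦⟧ K X)
negate-⟦⟧ (parʳ S K)  X = cong (tens (negate S)) (negate-⟦⟧ K X)
negate-⟦⟧ (tensˡ K S) X = cong (λ Y → par Y (negate S)) (negate-⟦⟧ K X)
negate-⟦⟧ (tensʳ S K) X = cong (par (negate S)) (negate-⟦⟧ K X)
negate-⟦⟧ (seqˡ K S)  X = cong (λ Y → seq Y (negate S)) (negate-⟦⟧ K X)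
negate-⟦⟧ (seqʳ S K)  X = cong (seq (negate S)) (negate-⟦⟧ K X)
negate-⟦⟧ (wnᶜ K)     X = cong oc (negate-⟦⟧ K X)
negate-⟦⟧ (ocᶜ K)     X = cong wn (negate-⟦⟧ K X)

negate-cong : ∀ {X Y} → X ≃ Y → negate X ≃ negate Y
negate-cong ≃-refl                = ≃-refl
negate-cong (≃-sym p)             = ≃-sym (negate-cong p)
negate-cong (≃-trans p q)         = ≃-trans (negate-cong p) (negate-cong q)
negate-cong (par-cong p q)        = tens-cong (negate-cong p) (negate-cong q)
negate-cong (tens-cong p q)       = par-cong (negate-cong p) (negate-cong q)
negate-cong (seq-cong p q)        = seq-cong (negate-cong p) (negate-cong q)
negate-cong (wn-cong p)           = oc-cong (negate-cong p)
negate-cong (oc-cong p)           = wn-cong (negate-cong p)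
negate-cong (axiom par-assoc)     = axiom tens-assoc
negate-cong (axiom tens-assoc)    = axiom par-assoc
negate-cong (axiom seq-assoc)     = axiom seq-assoc
negate-cong (axiom par-comm)      = axiom tens-comm
negate-cong (axiom tens-comm)     = axiom par-comm
negate-cong (axiom par-unitˡ)     = axiom tens-unitˡ
negate-cong (axiom par-unitʳ)     = axiom tens-unitʳ
negate-cong (axiom tens-unitˡ)    = axiom par-unitˡ
negate-cong (axiom tens-unitʳ)    = axiom par-unitʳ
negate-cong (axiom seq-unitˡ)     = axiom seq-unitˡ
negate-cong (axiom seq-unitʳ)     = axiom seq-unitʳ

corule : Rule → Rule
corule ai↓ = ai↑
corule ai↑ = ai↓
corule s   = s
corule q↓  = q↑
corule q↑  = q↓
corule p↓  = p↑
corule p↑  = p↓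

corule-involutive : ∀ r → corule (corule r) ≡ r
corule-involutive ai↓ = refl
corule-involutive ai↑ = refl
corule-involutive s   = refl
corule-involutive q↓  = refl
corule-involutive q↑  = refl
corule-involutive p↓  = refl
corule-involutive p↑  = refl

Co : RuleSet → RuleSet
Co 𝓡 r = 𝓡 (corule r)

Only-corule : ∀ {r} → Co (Only r) ⊆ Only (corule r)
Only-corule {_} {r'} eq = trans (sym (corule-involutive r')) (cong corule eq)

SNELh-corule : Co SNELh ⊆ SNELh
SNELh-corule {s}  _ = s∈
SNELh-corule {q↓} _ = q↓∈
SNELh-corule {q↑} _ = q↑∈
SNELh-corule {p↓} _ = p↓∈
SNELh-corule {p↑} _ = p↑∈
SNELh-corule {ai↓} ()
SNELh-corule {ai↑} ()

Inst-negate-⟦⟧ : ∀ {r} K {X Y} →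
                 Inst r (negateᶜ K ⟦ negate X ⟧) (negateᶜ K ⟦ negate Y ⟧) →
                 Inst r (negate (K ⟦ X ⟧)) (negate (K ⟦ Y ⟧))
Inst-negate-⟦⟧ K = subst₂ (Inst _) (sym (negate-⟦⟧ K _)) (sym (negate-⟦⟧ K _))

Inst-negate : ∀ {r P C} → Inst r P C → Inst (corule r) (negate C) (negate P)
Inst-negate (ai↓-i K a) = Inst-negate-⟦⟧ K (ai↑-i (negateᶜ K) (dual a))
Inst-negate (ai↑-i K a) = Inst-negate-⟦⟧ K (ai↓-i (negateᶜ K) (dual a))
Inst-negate (s-i K R T U) =
  Inst-negate-⟦⟧ K (s-i (negateᶜ K) (negate R) (negate U) (negate T))
Inst-negate (q↓-i K R T U V) =
  Inst-negate-⟦⟧ K (q↑-i (negateᶜ K) (negate R) (negate U) (negate T) (negate V))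
Inst-negate (q↑-i K R T U V) =
  Inst-negate-⟦⟧ K (q↓-i (negateᶜ K) (negate R) (negate U) (negate T) (negate V))
Inst-negate (p↓-i K R T) = Inst-negate-⟦⟧ K (p↑-i (negateᶜ K) (negate R) (negate T))
Inst-negate (p↑-i K R T) = Inst-negate-⟦⟧ K (p↓-i (negateᶜ K) (negate R) (negate T))

Der-negate : ∀ {𝓡 X Y} → Der 𝓡 X Y → Der (Co 𝓡) (negate Y) (negate X)
Der-negate (stop p) = stop (negate-cong (≃-sym p))
Der-negate {𝓡} (step r e p inst d) =
  Der-negate d ++ single (subst 𝓡 (sym (corule-involutive r)) e) (Inst-negate inst)
    ▻ negate-cong (≃-sym p)

ai↑-to-bottom : ∀ {M Z} → Der (SNELh ∪ Only ai↑) M Z →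
                Σ Str λ Z' → Der SNELh M Z' × Der (Only ai↑) Z' Z
ai↑-to-bottom {M} {Z} d
  with ai↓-to-top (λ e → e) (Der-mono (Sum.map SNELh-corule Only-corule) (Der-negate d))
... | N , a , e =
  negate N ,
  ≡⇒≃ (sym (negate-involutive M)) ◅ Der-mono SNELh-corule (Der-negate e) ,
  Der-mono Only-corule (Der-negate a) ▻ ≡⇒≃ (negate-involutive Z)

nnf : Str → Str
nnf (atom a)   = atom a
nnf ∘          = ∘
nnf (par R T)  = par (nnf R) (nnf T)
nnf (tens R T) = tens (nnf R) (nnf T)
nnf (seq R T)  = seq (nnf R) (nnf T)
nnf (wn R)     = wn (nnf R)
nnf (oc R)     = oc (nnf R)
nnf (neg R)    = negate (nnf R)

nnfᶜ : Ctx → Ctx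
nnfᶜ hole        = hole
nnfᶜ (parˡ K S)  = parˡ (nnfᶜ K) (nnf S)
nnfᶜ (parʳ S K)  = parʳ (nnf S) (nnfᶜ K)
nnfᶜ (tensˡ K S) = tensˡ (nnfᶜ K) (nnf S)
nnfᶜ (tensʳ S K) = tensʳ (nnf S) (nnfᶜ K)
nnfᶜ (seqˡ K S)  = seqˡ (nnfᶜ K) (nnf S)
nnfᶜ (seqʳ S K)  = seqʳ (nnf S) (nnfᶜ K)
nnfᶜ (wnᶜ K)     = wnᶜ (nnfᶜ K)
nnfᶜ (ocᶜ K)     = ocᶜ (nnfᶜ K)

nnf-⟦⟧ : ∀ K X → nnf (K ⟦ X ⟧) ≡ nnfᶜ K ⟦ nnf X ⟧
nnf-⟦⟧ hole        X = refl
nnf-⟦⟧ (parˡ K S)  X = cong (λ Y → par Y (nnf S)) (nnf-⟦⟧ K X)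
nnf-⟦⟧ (parʳ S K)  X = cong (par (nnf S)) (nnf-⟦⟧ K X)
nnf-⟦⟧ (tensˡ K S) X = cong (λ Y → tens Y (nnf S)) (nnf-⟦⟧ K X)
nnf-⟦⟧ (tensʳ S K) X = cong (tens (nnf S)) (nnf-⟦⟧ K X)
nnf-⟦⟧ (seqˡ K S)  X = cong (λ Y → seq Y (nnf S)) (nnf-⟦⟧ K X)
nnf-⟦⟧ (seqʳ S K)  X = cong (seq (nnf S)) (nnf-⟦⟧ K X)
nnf-⟦⟧ (wnᶜ K)     X = cong wn (nnf-⟦⟧ K X)
nnf-⟦⟧ (ocᶜ K)     X = cong oc (nnf-⟦⟧ K X)

Inst-nnf-⟦⟧ : ∀ {r} K {X Y} → Inst r (nnfᶜ K ⟦ nnf X ⟧) (nnfᶜ K ⟦ nnf Y ⟧) →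
              Inst r (nnf (K ⟦ X ⟧)) (nnf (K ⟦ Y ⟧))
Inst-nnf-⟦⟧ K = subst₂ (Inst _) (sym (nnf-⟦⟧ K _)) (sym (nnf-⟦⟧ K _))

Inst-nnf : ∀ {r P C} → Inst r P C → Inst r (nnf P) (nnf C)
Inst-nnf (ai↓-i K a)      = Inst-nnf-⟦⟧ K (ai↓-i (nnfᶜ K) a)
Inst-nnf (ai↑-i K a)      = Inst-nnf-⟦⟧ K (ai↑-i (nnfᶜ K) a)
Inst-nnf (s-i K R T U)    = Inst-nnf-⟦⟧ K (s-i (nnfᶜ K) (nnf R) (nnf T) (nnf U))
Inst-nnf (q↓-i K R T U V) = Inst-nnf-⟦⟧ K (q↓-i (nnfᶜ K) (nnf R) (nnf T) (nnf U) (nnf V))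
Inst-nnf (q↑-i K R T U V) = Inst-nnf-⟦⟧ K (q↑-i (nnfᶜ K) (nnf R) (nnf T) (nnf U) (nnf V))
Inst-nnf (p↓-i K R T)     = Inst-nnf-⟦⟧ K (p↓-i (nnfᶜ K) (nnf R) (nnf T))
Inst-nnf (p↑-i K R T)     = Inst-nnf-⟦⟧ K (p↑-i (nnfᶜ K) (nnf R) (nnf T))

nnf-cong : ∀ {X Y} → X ≈ Y → nnf X ≃ nnf Y
nnf-cong ≈-refl          = ≃-refl
nnf-cong (≈-sym p)       = ≃-sym (nnf-cong p)
nnf-cong (≈-trans p q)   = ≃-trans (nnf-cong p) (nnf-cong q)
nnf-cong (par-cong p q)  = par-cong (nnf-cong p) (nnf-cong q)
nnf-cong (tens-cong p q) = tens-cong (nnf-cong p) (nnf-cong q)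
nnf-cong (seq-cong p q)  = seq-cong (nnf-cong p) (nnf-cong q)
nnf-cong (wn-cong p)     = wn-cong (nnf-cong p)
nnf-cong (oc-cong p)     = oc-cong (nnf-cong p)
nnf-cong (neg-cong p)    = negate-cong (nnf-cong p)
nnf-cong par-assoc       = axiom par-assoc
nnf-cong tens-assoc      = axiom tens-assoc
nnf-cong seq-assoc       = axiom seq-assoc
nnf-cong par-comm        = axiom par-comm
nnf-cong tens-comm       = axiom tens-comm
nnf-cong par-unitˡ       = axiom par-unitˡ
nnf-cong par-unitʳ       = axiom par-unitʳ
nnf-cong tens-unitˡ      = axiom tens-unitˡ
nnf-cong tens-unitʳ      = axiom tens-unitʳ
nnf-cong seq-unitˡ       = axiom seq-unitˡ
nnf-cong seq-unitʳ       = axiom seq-unitʳ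
nnf-cong neg-atom        = ≃-refl
nnf-cong neg-unit        = ≃-refl
nnf-cong neg-par         = ≃-refl
nnf-cong neg-tens        = ≃-refl
nnf-cong neg-seq         = ≃-refl
nnf-cong neg-wn          = ≃-refl
nnf-cong neg-oc          = ≃-refl
nnf-cong (neg-neg {R})   = ≡⇒≃ (negate-involutive (nnf R))

neg≈negate : ∀ X → neg X ≈ negate X
neg≈negate (atom a)   = neg-atom
neg≈negate ∘          = neg-unit
neg≈negate (par R T)  = ≈-trans neg-par (tens-cong (neg≈negate R) (neg≈negate T))
neg≈negate (tens R T) = ≈-trans neg-tens (par-cong (neg≈negate R) (neg≈negate T))
neg≈negate (seq R T)  = ≈-trans neg-seq (seq-cong (neg≈negate R) (neg≈negate T))
neg≈negate (wn R)     = ≈-trans neg-wn (oc-cong (neg≈negate R))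
neg≈negate (oc R)     = ≈-trans neg-oc (wn-cong (neg≈negate R))
neg≈negate (neg X)    = neg-cong (neg≈negate X)

≈-nnf : ∀ X → X ≈ nnf X
≈-nnf (atom a)   = ≈-refl
≈-nnf ∘          = ≈-refl
≈-nnf (par R T)  = par-cong (≈-nnf R) (≈-nnf T)
≈-nnf (tens R T) = tens-cong (≈-nnf R) (≈-nnf T)
≈-nnf (seq R T)  = seq-cong (≈-nnf R) (≈-nnf T)
≈-nnf (wn R)     = wn-cong (≈-nnf R)
≈-nnf (oc R)     = oc-cong (≈-nnf R)
≈-nnf (neg R)    = ≈-trans (neg-cong (≈-nnf R)) (neg≈negate (nnf R))

Deriv⇒Der : ∀ {𝓡 X Y} → Deriv 𝓡 X Y → Der 𝓡 (nnf X) (nnf Y)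
Deriv⇒Der (stop p)            = stop (nnf-cong p)
Deriv⇒Der (step r e p inst d) = step r e (nnf-cong p) (Inst-nnf inst) (Deriv⇒Der d)

Der⇒Deriv : ∀ {𝓡 X Y} → Der 𝓡 X Y → Deriv 𝓡 X Y
Der⇒Deriv (stop p)            = stop (≃⇒≈ p)
Der⇒Deriv (step r e p inst d) = step r e (≃⇒≈ p) inst (Der⇒Deriv d)

Deriv-pre : ∀ {𝓡 X Y Z} → X ≈ Y → Deriv 𝓡 Y Z → Deriv 𝓡 X Z
Deriv-pre p (stop q)            = stop (≈-trans p q)
Deriv-pre p (step r e q inst d) = step r e (≈-trans p q) inst d

Deriv-post : ∀ {𝓡 X Y Z} → Deriv 𝓡 X Y → Y ≈ Z → Deriv 𝓡 X Z
Deriv-post (stop p)            q = stop (≈-trans p q)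
Deriv-post (step r e p inst d) q = step r e p inst (Deriv-post d q)

AllRules-split : AllRules ⊆ ((SNELh ∪ Only ai↑) ∪ Only ai↓)
AllRules-split {ai↓} _ = inj₂ refl
AllRules-split {ai↑} _ = inj₁ (inj₂ refl)
AllRules-split {s}   _ = inj₁ (inj₁ s∈)
AllRules-split {q↓}  _ = inj₁ (inj₁ q↓∈)
AllRules-split {q↑}  _ = inj₁ (inj₁ q↑∈)
AllRules-split {p↓}  _ = inj₁ (inj₁ p↓∈)
AllRules-split {p↑}  _ = inj₁ (inj₁ p↑∈)

lemma4p7 : (W₄ Z₄ : Str) → Deriv AllRules W₄ Z₄ →
    Σ Str (λ W₅ → Σ Str (λ Z₅ →
      Deriv (Only ai↓) W₄ W₅ × Deriv SNELh W₅ Z₅ × Deriv (Only ai↑) Z₅ Z₄))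
lemma4p7 W₄ Z₄ d with ai↓-to-top inj₁ (Der-mono AllRules-split (Deriv⇒Der d))
... | W₅ , top , rest with ai↑-to-bottom rest
... | Z₅ , middle , bottom =
  W₅ , Z₅ ,
  Deriv-pre (≈-nnf W₄) (Der⇒Deriv top) ,
  Der⇒Deriv middle ,
  Deriv-post (Der⇒Deriv bottom) (≈-sym (≈-nnf Z₄))
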